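{- Let $C^{\geq}(x,q;1)=\sum_{n\ge1}x^n\sum_w q^{\mathrm{inter}(w)}$, the inner sum over all Catalan words $w$ of length $n$ avoiding the pattern $(\geq,\geq)$. Let $H(x,q)=\sum_{w\in\mathcal{B},\,w\ne\epsilon}x^{|w|}q^{\mathrm{inter}(w)}$, where $\mathcal{B}$ is the set of Catalan words avoiding $(\geq,\geq)$ that do not end with two letters $ab$ with $a\ge b$. Then \[ C^{\geq}(x,q;1)= \sum_{i=1}^{\infty} x^i q^{\frac{(i-2)(i-1)}{2}} \prod_{j=0}^{i-1} \left(1+H\!\left(x q^j, q \right)\right). \]
   Context: A Catalan word of length $n\ge 0$ is a sequence $w=w_1\cdots w_n$ of non-negative integers with $w_1=0$ and $0\le w_i\le w_{i-1}+1$ for $i=2,\dots,n$; $|w|$ is its length and $\epsilon$ the empty word. It avoids the pattern $(\geq,\geq)$ if there is no index $i$ with $w_i\ge w_{i+1}\ge w_{i+2}$. To $w$ is associated the polyomino $P(w)$ with $n$ bottom-aligned columns, the $i$-th column consisting of $w_i+1$ unit cells. $\mathrm{inter}(w)$ is the number of lattice points belonging to exactly four cells of $P(w)$. -}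

module Defs where

open import Data.Nat using (ℕ; zero; suc; _+_; _*_; _∸_; _≤ᵇ_; _≡ᵇ_; _≤_)
open import Data.Nat.DivMod using (_/_)
open import Data.Bool using (Bool; true; false; _∧_; not; if_then_else_)
open import Data.List using (List; []; _∷_; length; map; upTo; concatMap; filterᵇ)
open import Data.Nat.ListAction using (sum)
open import Data.Maybe using (Maybe; just; nothing)
open import Data.Product using (_×_; _,_)
open import Relation.Nullary.Decidable using (does)
open import Relation.Binary.PropositionalEquality using (_≡_)

Word : Set
Word = List ℕ

stepsOK : ℕ → Word → Bool
stepsOK prev []      = true
stepsOK prev (b ∷ r) = (b ≤ᵇ suc prev) ∧ stepsOK b r

isCatalan : Word → Bool
isCatalan []      = true
isCatalan (a ∷ r) = (a ≡ᵇ 0) ∧ stepsOK a r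

avoidsGG : Word → Bool
avoidsGG (a ∷ b ∷ c ∷ r) = not ((b ≤ᵇ a) ∧ (c ≤ᵇ b)) ∧ avoidsGG (b ∷ c ∷ r)
avoidsGG _               = true

endsWeakDescent : Word → Bool
endsWeakDescent (a ∷ b ∷ []) = b ≤ᵇ a
endsWeakDescent (a ∷ b ∷ r)  = endsWeakDescent (b ∷ r)
endsWeakDescent _            = false

inCGG : Word → Bool
inCGG w = isCatalan w ∧ avoidsGG w

inB : Word → Bool
inB w = inCGG w ∧ not (endsWeakDescent w)

-- column c (0-indexed) of P(w) consists of the cells [c,c+1]×[r,r+1], 0 ≤ r ≤ w_{c+1}
lookupW : Word → ℕ → Maybe ℕ
lookupW []      _       = nothing
lookupW (a ∷ _) zero    = just a
lookupW (_ ∷ w) (suc c) = lookupW w c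

isCell : Word → ℕ → ℕ → Bool
isCell w c r with lookupW w c
... | just h  = r ≤ᵇ h
... | nothing = false

b2n : Bool → ℕ
b2n true  = 1
b2n false = 0

-- the lattice point (x,y) belongs to the cells (c,r) with c ∈ {x-1,x}, r ∈ {y-1,y}
cellsAt : Word → ℕ → ℕ → ℕ
cellsAt w zero    zero    = b2n (isCell w 0 0)
cellsAt w zero    (suc y) = b2n (isCell w 0 y) + b2n (isCell w 0 (suc y))
cellsAt w (suc x) zero    = b2n (isCell w x 0) + b2n (isCell w (suc x) 0)
cellsAt w (suc x) (suc y) =
  b2n (isCell w x y) + b2n (isCell w x (suc y))
  + b2n (isCell w (suc x) y) + b2n (isCell w (suc x) (suc y))

-- all lattice points in the box [0,|w|] × [0, 1 + Σ w], which contains P(w)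
latticeBox : Word → List (ℕ × ℕ)
latticeBox w = concatMap (λ x → map (λ y → (x , y)) (upTo (suc (suc (sum w)))))
                         (upTo (suc (length w)))

inter : Word → ℕ
inter w = length (filterᵇ (λ p → cellsAt' p ≡ᵇ 4) (latticeBox w))
  where
  cellsAt' : ℕ × ℕ → ℕ
  cellsAt' (x , y) = cellsAt w x y

wordsOf : ℕ → ℕ → List Word
wordsOf zero    m = [] ∷ []
wordsOf (suc n) m = concatMap (λ a → map (a ∷_) (wordsOf n m)) (upTo m)

-- number of words of length n satisfying P with inter(w) = k
-- (letters of a Catalan word of length n are < n, so wordsOf n n suffices)
countWords : (Word → Bool) → ℕ → ℕ → ℕ
countWords P n k = length (filterᵇ (λ w → inter w ≡ᵇ k)
                                  (filterᵇ P (wordsOf n n)))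

-- Formal power series in x, q with ℕ coefficients:
-- f n k = coefficient of x^n q^k.
FPS : Set
FPS = ℕ → ℕ → ℕ

Σ≤ : ℕ → (ℕ → ℕ) → ℕ
Σ≤ n f = sum (map f (upTo (suc n)))

oneS : FPS
oneS zero zero = 1
oneS _    _    = 0

_⊕_ : FPS → FPS → FPS
(f ⊕ g) n k = f n k + g n k

_⊛_ : FPS → FPS → FPS
(f ⊛ g) n k = Σ≤ n (λ a → Σ≤ k (λ b → f a b * g (n ∸ a) (k ∸ b)))

mono : ℕ → ℕ → FPS
mono i m n k = b2n ((n ≡ᵇ i) ∧ (k ≡ᵇ m))

substXQ : ℕ → FPS → FPS
substXQ j f n k = if (j * n) ≤ᵇ k then f n (k ∸ j * n) else 0

prodS : ℕ → (ℕ → FPS) → FPS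
prodS zero    F = oneS
prodS (suc i) F = prodS i F ⊛ F i

partialSum : ℕ → (ℕ → FPS) → FPS
partialSum zero    T n k = 0
partialSum (suc N) T n k = partialSum N T n k + T (suc N) n k

Cgeq : FPS
Cgeq zero    k = 0
Cgeq (suc n) k = countWords inCGG (suc n) k

H : FPS
H zero    k = 0
H (suc n) k = countWords inB (suc n) k

-- i-th summand x^i q^{(i-2)(i-1)/2} ∏_{j=0}^{i-1} (1 + H(x q^j, q))
-- (for i ≥ 1, (i-2)(i-1) = (i∸2)(i∸1) in ℕ)
rhsTerm : ℕ → FPS
rhsTerm i = mono i (((i ∸ 2) * (i ∸ 1)) / 2) ⊛ prodS i (λ j → oneS ⊕ substXQ j H)

{-# OPTIONS --safe #-}
-- Sort the words of C^≥ by the height i of their last column, i.e. by their last letter i − 1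
-- (ε is the only word of height 0). Cutting a word of height i + 1 right after its last letter
-- below i writes it uniquely as x · (v + i), where x has height i, v ∈ C^≥ ends with 0 and v + i
-- adds i to every letter; the words of C^≥ ending with 0 are exactly u0 with u ∈ 𝓑 ∪ {ε}.
-- Since inter(w) is the sum of min(w_j, w_{j+1}) over adjacent letters,
-- inter(x · (u0 + i)) = inter x + (i − 1) + inter u + i|u|, so the words of height i + 1 have
-- generating function (words of height i) · x q^(i−1) (1 + H(x q^i, q)). By induction the words of
-- height i contribute x^i q^((i−2)(i−1)/2) ∏_{j<i} (1 + H(x q^j, q)), and C^≥ is the sum over i ≥ 1.
-- Coefficients are compared as sums over all words of a fixed length over a large enough alphabet,
-- where a product of series becomes a concatenation of words.
module Submission where

open import Defs
open import Data.Nat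
open import Data.Nat.Properties
open import Data.Nat.ListAction using (sum)
open import Data.Nat.ListAction.Properties using (sum-++)
open import Data.Nat.DivMod using (_/_; m*n/n≡m)
open import Data.Nat.Solver using (module +-*-Solver)
open import Data.Bool using (Bool; true; false; _∧_; not)
open import Data.Bool.Properties using (∧-assoc; ∧-zeroʳ; ∧-identityʳ; ∧-conicalˡ; ∧-conicalʳ)
open import Data.Bool.ListAction using (all)
open import Data.Empty using (⊥; ⊥-elim)
open import Data.Maybe using (Maybe; just; nothing)
open import Data.Product using (_×_; _,_; proj₁; proj₂; ∃; Σ-syntax)
open import Data.Sum using (_⊎_; inj₁; inj₂)
open import Data.List
  using (List; []; _∷_; _++_; _∷ʳ_; length; map; take; drop; upTo; applyUpTo; concatMap; filterᵇ)
open import Data.List.Properties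
  using (map-++; map-∘; map-cong; map-id; ++-identityʳ; ∷-injective; length-++; length-map; length-take; take++drop≡id)
open import Data.List.Relation.Unary.All as All using (All; []; _∷_)
open import Data.List.Relation.Unary.All.Properties using (++⁻ˡ)
open import Function using (_∘_; id; _⇔_; mk⇔)
open import Relation.Nullary using (¬_; Dec; yes; no; does; ofʸ; ofⁿ)
open import Relation.Nullary.Decidable using (dec-true; dec-false; does-⇔)
open import Relation.Binary.PropositionalEquality
open import Algebra.Properties.CommutativeSemigroup +-commutativeSemigroup using (interchange)
open +-*-Solver

dec-witness : ∀ {A : Set} (a? : Dec A) → does a? ≡ true → A
dec-witness (yes a) _  = a
dec-witness (no _)  ()

∧-elim : ∀ a {b} → (a ∧ b) ≡ true → a ≡ true × b ≡ true
∧-elim a {b} h = ∧-conicalˡ a b h , ∧-conicalʳ a b h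

∧-intro : ∀ {a b} → a ≡ true → b ≡ true → (a ∧ b) ≡ true
∧-intro refl refl = refl

b2n-∧ : ∀ a b → b2n (a ∧ b) ≡ b2n a * b2n b
b2n-∧ true  b = sym (+-identityʳ (b2n b))
b2n-∧ false b = refl

≤ᵇ-+ʳ : ∀ m n i → (m + i ≤ᵇ n + i) ≡ (m ≤ᵇ n)
≤ᵇ-+ʳ m n i = does-⇔ (mk⇔ (+-cancelʳ-≤ i m n) (+-monoˡ-≤ i)) (m + i ≤? n + i) (m ≤? n)

≡ᵇ-+ʳ : ∀ m n i → (m + i ≡ᵇ n + i) ≡ (m ≡ᵇ n)
≡ᵇ-+ʳ m n i = does-⇔ (mk⇔ (+-cancelʳ-≡ i m n) (cong (_+ i))) (m + i ≟ n + i) (m ≟ n)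

≡∸⇔+≡ : ∀ {m n o} → n ≤ o → (m ≡ o ∸ n) ⇔ (m + n ≡ o)
≡∸⇔+≡ {m} {n} n≤o = mk⇔ (λ e → trans (cong (_+ n) e) (m∸n+n≡m n≤o))
                         (λ e → trans (sym (m+n∸n≡m m n)) (cong (_∸ n) e))


-- Finite sums

sumBelow : ℕ → (ℕ → ℕ) → ℕ
sumBelow zero    f = 0
sumBelow (suc m) f = f 0 + sumBelow m (f ∘ suc)
syntax sumBelow m (λ a → t) = ∑[ a < m ] t

sumBelow-cong : ∀ m {f g : ℕ → ℕ} → (∀ a → a < m → f a ≡ g a) → sumBelow m f ≡ sumBelow m g
sumBelow-cong zero    f≗g = refl
sumBelow-cong (suc m) f≗g =
  cong₂ _+_ (f≗g 0 z<s) (sumBelow-cong m (λ a a<m → f≗g (suc a) (s<s a<m)))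

sumBelow-vanishing : ∀ m {f : ℕ → ℕ} → (∀ a → a < m → f a ≡ 0) → sumBelow m f ≡ 0
sumBelow-vanishing zero    f≗0 = refl
sumBelow-vanishing (suc m) f≗0 =
  cong₂ _+_ (f≗0 0 z<s) (sumBelow-vanishing m (λ a a<m → f≗0 (suc a) (s<s a<m)))

sumBelow-+ : ∀ m (f g : ℕ → ℕ) → ∑[ a < m ] (f a + g a) ≡ sumBelow m f + sumBelow m g
sumBelow-+ zero    f g = refl
sumBelow-+ (suc m) f g = trans (cong (f 0 + g 0 +_) (sumBelow-+ m (f ∘ suc) (g ∘ suc)))
                               (interchange (f 0) (g 0) _ _)

sumBelow-*ˡ : ∀ m c (f : ℕ → ℕ) → ∑[ a < m ] (c * f a) ≡ c * sumBelow m f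
sumBelow-*ˡ zero    c f = sym (*-zeroʳ c)
sumBelow-*ˡ (suc m) c f =
  trans (cong (c * f 0 +_) (sumBelow-*ˡ m c (f ∘ suc))) (sym (*-distribˡ-+ c (f 0) _))

sumBelow-*ʳ : ∀ m c (f : ℕ → ℕ) → ∑[ a < m ] (f a * c) ≡ sumBelow m f * c
sumBelow-*ʳ zero    c f = refl
sumBelow-*ʳ (suc m) c f =
  trans (cong (f 0 * c +_) (sumBelow-*ʳ m c (f ∘ suc))) (sym (*-distribʳ-+ c (f 0) _))

sumBelow-split : ∀ i m (f : ℕ → ℕ) → sumBelow (i + m) f ≡ sumBelow i f + ∑[ a < m ] f (i + a)
sumBelow-split zero    m f = refl
sumBelow-split (suc i) m f =
  trans (cong (f 0 +_) (sumBelow-split i m (f ∘ suc))) (sym (+-assoc (f 0) _ _))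

sumBelow-suc : ∀ m (f : ℕ → ℕ) → sumBelow (suc m) f ≡ sumBelow m f + f m
sumBelow-suc zero    f = +-identityʳ (f 0)
sumBelow-suc (suc m) f =
  trans (cong (f 0 +_) (sumBelow-suc m (f ∘ suc))) (sym (+-assoc (f 0) _ _))

sumBelow-swap : ∀ m p (g : ℕ → ℕ → ℕ) → ∑[ a < m ] ∑[ b < p ] g a b ≡ ∑[ b < p ] ∑[ a < m ] g a b
sumBelow-swap zero    p g = sym (sumBelow-vanishing p (λ _ _ → refl))
sumBelow-swap (suc m) p g =
  trans (cong (sumBelow p (g 0) +_) (sumBelow-swap m p (g ∘ suc)))
        (sym (sumBelow-+ p (g 0) (λ b → ∑[ a < m ] g (suc a) b)))

sumBelow-single : ∀ m p (f : ℕ → ℕ) → p < m → (∀ a → a < m → a ≢ p → f a ≡ 0) → sumBelow m f ≡ f p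
sumBelow-single (suc m) zero    f p<m others =
  trans (cong (f 0 +_) (sumBelow-vanishing m (λ a a<m → others (suc a) (s<s a<m) λ ())))
        (+-identityʳ (f 0))
sumBelow-single (suc m) (suc p) f (s<s p<m) others =
  trans (cong (_+ sumBelow m (f ∘ suc)) (others 0 z<s λ ()))
        (sumBelow-single m p (f ∘ suc) p<m (λ a a<m a≢p → others (suc a) (s<s a<m) (a≢p ∘ suc-injective)))

sumBelow-δ : ∀ n p (g : ℕ → ℕ) → ∑[ a < suc n ] (b2n (a ≡ᵇ p) * g a) ≡ b2n (p ≤ᵇ n) * g p
sumBelow-δ n p g with p ≤ᵇ n | ≤ᵇ-reflects-≤ p n
... | true  | ofʸ p≤n =
  trans (sumBelow-single (suc n) p (λ a → b2n (a ≡ᵇ p) * g a) (s≤s p≤n)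
                         (λ a _ a≢p → cong (λ t → b2n t * g a) (dec-false (a ≟ p) a≢p)))
        (cong (λ t → b2n t * g p) (dec-true (p ≟ p) refl))
... | false | ofⁿ p≰n = sumBelow-vanishing (suc n) λ a a<1+n →
  cong (λ t → b2n t * g a) (dec-false (a ≟ p) λ { refl → p≰n (≤-pred a<1+n) })

convolve-δ : ∀ p Y k → ∑[ b < suc k ] (b2n (p ≡ᵇ b) * b2n (Y ≡ᵇ k ∸ b)) ≡ b2n (p + Y ≡ᵇ k)
convolve-δ zero    Y k       =
  trans (cong₂ _+_ (+-identityʳ (b2n (Y ≡ᵇ k))) (sumBelow-vanishing k (λ _ _ → refl))) (+-identityʳ _)
convolve-δ (suc p) Y zero    = refl
convolve-δ (suc p) Y (suc k) = convolve-δ p Y k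

convolve-shifted : ∀ X Y E k → E ≤ X →
                   ∑[ b < suc k ] (b2n (X ≡ᵇ b + E) * b2n (Y ≡ᵇ k ∸ b)) ≡ b2n (X + Y ≡ᵇ k + E)
convolve-shifted X Y E k E≤X = begin
    ∑[ b < suc k ] (b2n (X ≡ᵇ b + E) * b2n (Y ≡ᵇ k ∸ b))
  ≡⟨ sumBelow-cong (suc k) (λ b _ → cong (λ t → b2n t * b2n (Y ≡ᵇ k ∸ b))
       (does-⇔ (mk⇔ (λ e → trans (cong (_∸ E) e) (m+n∸n≡m b E)) (λ e → trans (sym X∸E+E) (cong (_+ E) e)))
               (X ≟ b + E) (X ∸ E ≟ b))) ⟩
    ∑[ b < suc k ] (b2n (X ∸ E ≡ᵇ b) * b2n (Y ≡ᵇ k ∸ b))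
  ≡⟨ convolve-δ (X ∸ E) Y k ⟩
    b2n (X ∸ E + Y ≡ᵇ k)
  ≡⟨ cong b2n (trans (sym (≡ᵇ-+ʳ (X ∸ E + Y) k E)) (cong (_≡ᵇ k + E) rearrange)) ⟩
    b2n (X + Y ≡ᵇ k + E)
  ∎
  where
  open ≡-Reasoning
  X∸E+E : X ∸ E + E ≡ X
  X∸E+E = m∸n+n≡m E≤X
  rearrange : X ∸ E + Y + E ≡ X + Y
  rearrange = trans (solve 3 (λ p y e → p :+ y :+ e := p :+ e :+ y) refl (X ∸ E) Y E) (cong (_+ Y) X∸E+E)


-- Sums over words

IsWord : ℕ → ℕ → Word → Set
IsWord n m w = length w ≡ n × All (_< m) w

∷-IsWord : ∀ {n m a w} → a < m → IsWord n m w → IsWord (suc n) m (a ∷ w)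
∷-IsWord a<m (len , bounded) = cong suc len , a<m ∷ bounded

sumWords : ℕ → ℕ → (Word → ℕ) → ℕ
sumWords zero    m f = f []
sumWords (suc n) m f = ∑[ a < m ] sumWords n m (f ∘ (a ∷_))

sumWords-cong : ∀ n m {f g : Word → ℕ} → (∀ w → IsWord n m w → f w ≡ g w) →
                sumWords n m f ≡ sumWords n m g
sumWords-cong zero    m f≗g = f≗g [] (refl , [])
sumWords-cong (suc n) m f≗g =
  sumBelow-cong m (λ a a<m → sumWords-cong n m (λ w w∈ → f≗g (a ∷ w) (∷-IsWord a<m w∈)))

sumWords-vanishing : ∀ n m {f : Word → ℕ} → (∀ w → IsWord n m w → f w ≡ 0) → sumWords n m f ≡ 0
sumWords-vanishing zero    m f≗0 = f≗0 [] (refl , [])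
sumWords-vanishing (suc n) m f≗0 =
  sumBelow-vanishing m (λ a a<m → sumWords-vanishing n m (λ w w∈ → f≗0 (a ∷ w) (∷-IsWord a<m w∈)))

sumWords-*ˡ : ∀ n m c (f : Word → ℕ) → sumWords n m (λ w → c * f w) ≡ c * sumWords n m f
sumWords-*ˡ zero    m c f = refl
sumWords-*ˡ (suc n) m c f =
  trans (sumBelow-cong m (λ a _ → sumWords-*ˡ n m c (f ∘ (a ∷_)))) (sumBelow-*ˡ m c _)

sumWords-sumBelow : ∀ n m p (f : ℕ → Word → ℕ) →
                    sumWords n m (λ w → ∑[ b < p ] f b w) ≡ ∑[ b < p ] sumWords n m (f b)
sumWords-sumBelow zero    m p f = refl
sumWords-sumBelow (suc n) m p f =
  trans (sumBelow-cong m (λ a _ → sumWords-sumBelow n m p (λ b w → f b (a ∷ w)))) (sumBelow-swap m p _)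

sumWords-split : ∀ n₁ n₂ m (f g : Word → ℕ) →
                 sumWords (n₁ + n₂) m (λ w → f (take n₁ w) * g (drop n₁ w)) ≡ sumWords n₁ m f * sumWords n₂ m g
sumWords-split zero     n₂ m f g = sumWords-*ˡ n₂ m (f []) g
sumWords-split (suc n₁) n₂ m f g =
  trans (sumBelow-cong m (λ a _ → sumWords-split n₁ n₂ m (f ∘ (a ∷_)) g)) (sumBelow-*ʳ m _ _)

take-length-++ : ∀ {A : Set} (x y : List A) → take (length x) (x ++ y) ≡ x
take-length-++ []      y = refl
take-length-++ (a ∷ x) y = cong (a ∷_) (take-length-++ x y)

drop-length-++ : ∀ {A : Set} (x y : List A) → drop (length x) (x ++ y) ≡ y
drop-length-++ []      y = refl
drop-length-++ (a ∷ x) y = drop-length-++ x y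

sumWords-split-at : ∀ a i n m (f g : Word → ℕ) → a ≤ n →
  sumWords (a + i) m f * sumWords (suc (n ∸ a)) m g ≡
  sumWords (n + suc i) m (λ w → f (take (a + i) w) * g (drop (a + i) w))
sumWords-split-at a i n m f g a≤n =
  trans (sym (sumWords-split (a + i) (suc (n ∸ a)) m f g))
        (cong (λ l → sumWords l m (λ w → f (take (a + i) w) * g (drop (a + i) w))) length≡)
  where
  length≡ : a + i + suc (n ∸ a) ≡ n + suc i
  length≡ = trans (solve 3 (λ a i d → a :+ i :+ (con 1 :+ d) := a :+ d :+ (con 1 :+ i)) refl a i (n ∸ a))
                  (cong (_+ suc i) (m+[n∸m]≡n a≤n))

sumWords-alphabet : ∀ n {m m′} (f : Word → ℕ) → m ≤ m′ →
                    (∀ w → IsWord n m′ w → ¬ All (_< m) w → f w ≡ 0) → sumWords n m f ≡ sumWords n m′ f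
sumWords-alphabet zero    f m≤m′ outside = refl
sumWords-alphabet (suc n) {m} {m′} f m≤m′ outside = begin
    ∑[ a < m ] sumWords n m (f ∘ (a ∷_))
  ≡⟨ sumBelow-cong m (λ a a<m → sumWords-alphabet n (f ∘ (a ∷_)) m≤m′ λ w w∈ ¬bounded →
       outside (a ∷ w) (∷-IsWord (<-≤-trans a<m m≤m′) w∈) λ { (_ ∷ bounded) → ¬bounded bounded }) ⟩
    ∑[ a < m ] sumWords n m′ (f ∘ (a ∷_))
  ≡⟨ sym (+-identityʳ _) ⟩
    ∑[ a < m ] sumWords n m′ (f ∘ (a ∷_)) + 0
  ≡⟨ cong (∑[ a < m ] sumWords n m′ (f ∘ (a ∷_)) +_) (sym (sumBelow-vanishing (m′ ∸ m) λ a a<m′∸m →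
       sumWords-vanishing n m′ λ w w∈ →
         outside (m + a ∷ w) (∷-IsWord (<-≤-trans (+-monoʳ-< m a<m′∸m) (≤-reflexive (m+[n∸m]≡n m≤m′))) w∈)
                 λ { (m+a<m ∷ _) → m+n≮m m a m+a<m })) ⟩
    ∑[ a < m ] sumWords n m′ (f ∘ (a ∷_)) + ∑[ a < m′ ∸ m ] sumWords n m′ (f ∘ (m + a ∷_))
  ≡⟨ sym (sumBelow-split m (m′ ∸ m) _) ⟩
    sumBelow (m + (m′ ∸ m)) (λ a → sumWords n m′ (f ∘ (a ∷_)))
  ≡⟨ cong (λ l → sumBelow l (λ a → sumWords n m′ (f ∘ (a ∷_)))) (m+[n∸m]≡n m≤m′) ⟩
    ∑[ a < m′ ] sumWords n m′ (f ∘ (a ∷_))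
  ∎
  where open ≡-Reasoning

sumWords-shift : ∀ n i m (g : Word → ℕ) → (∀ w → ¬ All (i ≤_) w → g w ≡ 0) →
                 sumWords n (i + m) g ≡ sumWords n m (g ∘ map (_+ i))
sumWords-shift zero    i m g below = refl
sumWords-shift (suc n) i m g below = begin
    ∑[ a < i + m ] sumWords n (i + m) (g ∘ (a ∷_))
  ≡⟨ sumBelow-split i m _ ⟩
    ∑[ a < i ] sumWords n (i + m) (g ∘ (a ∷_)) + ∑[ a < m ] sumWords n (i + m) (g ∘ (i + a ∷_))
  ≡⟨ cong₂ _+_ (sumBelow-vanishing i λ a a<i → sumWords-vanishing n (i + m) λ w _ →
                  below (a ∷ w) λ { (i≤a ∷ _) → <⇒≱ a<i i≤a })
               (sumBelow-cong m λ a _ → trans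
                  (sumWords-shift n i m (g ∘ (i + a ∷_)) λ w ¬above →
                     below (i + a ∷ w) λ { (_ ∷ above) → ¬above above })
                  (cong (λ b → sumWords n m (λ w → g (b ∷ map (_+ i) w))) (+-comm i a))) ⟩
    ∑[ a < m ] sumWords n m (g ∘ map (_+ i) ∘ (a ∷_))
  ∎
  where open ≡-Reasoning

sumWords-∷ʳ : ∀ n m (h : Word → ℕ) → sumWords (suc n) m h ≡ ∑[ a < m ] sumWords n m (λ t → h (t ∷ʳ a))
sumWords-∷ʳ zero    m h = refl
sumWords-∷ʳ (suc n) m h =
  trans (sumBelow-cong m (λ b _ → sumWords-∷ʳ n m (h ∘ (b ∷_))))
        (sumBelow-swap m m (λ b a → sumWords n m (λ t → h (b ∷ (t ∷ʳ a)))))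

sum-map-applyUpTo : ∀ m (g f : ℕ → ℕ) → sum (map f (applyUpTo g m)) ≡ ∑[ a < m ] f (g a)
sum-map-applyUpTo zero    g f = refl
sum-map-applyUpTo (suc m) g f = cong (f (g 0) +_) (sum-map-applyUpTo m (g ∘ suc) f)

Σ≤≡sumBelow : ∀ n f → Σ≤ n f ≡ sumBelow (suc n) f
Σ≤≡sumBelow n f = sum-map-applyUpTo (suc n) id f

sum-map-concatMap : ∀ {A B : Set} (f : B → ℕ) (g : A → List B) xs →
                    sum (map f (concatMap g xs)) ≡ sum (map (λ x → sum (map f (g x))) xs)
sum-map-concatMap f g []       = refl
sum-map-concatMap f g (x ∷ xs) =
  trans (cong sum (map-++ f (g x) (concatMap g xs)))
        (trans (sum-++ (map f (g x)) _) (cong (sum (map f (g x)) +_) (sum-map-concatMap f g xs)))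

length-filterᵇ : ∀ {A : Set} (p : A → Bool) xs → length (filterᵇ p xs) ≡ sum (map (b2n ∘ p) xs)
length-filterᵇ p []       = refl
length-filterᵇ p (x ∷ xs) with p x
... | true  = cong suc (length-filterᵇ p xs)
... | false = length-filterᵇ p xs

sum-map-filterᵇ : ∀ {A : Set} (p : A → Bool) (f : A → ℕ) xs →
                  sum (map f (filterᵇ p xs)) ≡ sum (map (λ x → b2n (p x) * f x) xs)
sum-map-filterᵇ p f []       = refl
sum-map-filterᵇ p f (x ∷ xs) with p x
... | true  = cong₂ _+_ (sym (+-identityʳ (f x))) (sum-map-filterᵇ p f xs)
... | false = sum-map-filterᵇ p f xs

sum-map-wordsOf : ∀ n m (f : Word → ℕ) → sum (map f (wordsOf n m)) ≡ sumWords n m f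
sum-map-wordsOf zero    m f = +-identityʳ (f [])
sum-map-wordsOf (suc n) m f = begin
    sum (map f (concatMap (λ a → map (a ∷_) (wordsOf n m)) (upTo m)))
  ≡⟨ sum-map-concatMap f _ (upTo m) ⟩
    sum (map (λ a → sum (map f (map (a ∷_) (wordsOf n m)))) (upTo m))
  ≡⟨ sum-map-applyUpTo m id _ ⟩
    ∑[ a < m ] sum (map f (map (a ∷_) (wordsOf n m)))
  ≡⟨ sumBelow-cong m (λ a _ → trans (cong sum (sym (map-∘ (wordsOf n m))))
                                     (sum-map-wordsOf n m (f ∘ (a ∷_)))) ⟩
    sumWords (suc n) m f
  ∎
  where open ≡-Reasoning

countWords≡sumWords : ∀ P n k → countWords P n k ≡ sumWords n n (λ w → b2n (P w) * b2n (inter w ≡ᵇ k))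
countWords≡sumWords P n k = begin
    length (filterᵇ (λ w → inter w ≡ᵇ k) (filterᵇ P (wordsOf n n)))
  ≡⟨ length-filterᵇ _ (filterᵇ P (wordsOf n n)) ⟩
    sum (map (λ w → b2n (inter w ≡ᵇ k)) (filterᵇ P (wordsOf n n)))
  ≡⟨ sum-map-filterᵇ P _ (wordsOf n n) ⟩
    sum (map (λ w → b2n (P w) * b2n (inter w ≡ᵇ k)) (wordsOf n n))
  ≡⟨ sum-map-wordsOf n n _ ⟩
    sumWords n n (λ w → b2n (P w) * b2n (inter w ≡ᵇ k))
  ∎
  where open ≡-Reasoning


-- inter(w) as a sum of minima of adjacent letters

minSumFrom : ℕ → Word → ℕ
minSumFrom p []      = 0
minSumFrom p (b ∷ r) = p ⊓ b + minSumFrom b r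

minSum : Word → ℕ
minSum []      = 0
minSum (a ∷ r) = minSumFrom a r

inColumn : Maybe ℕ → ℕ → Bool
inColumn (just h) r = r ≤ᵇ h
inColumn nothing  r = false

minHeight : Maybe ℕ → Maybe ℕ → ℕ
minHeight (just a) (just b) = a ⊓ b
minHeight _        _        = 0

isCell≡inColumn : ∀ w c r → isCell w c r ≡ inColumn (lookupW w c) r
isCell≡inColumn w c r with lookupW w c
... | just h  = refl
... | nothing = refl

inColumn-down : ∀ s y → inColumn s (suc y) ≡ true → inColumn s y ≡ true
inColumn-down (just h) y 1+y≤h = dec-true (y ≤? h) (≤-trans (n≤1+n y) (dec-witness (suc y ≤? h) 1+y≤h))

b2n-sum₄≡ᵇ4 : ∀ p q r s → (b2n p + b2n q + b2n r + b2n s ≡ᵇ 4) ≡ (p ∧ q ∧ r ∧ s)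
b2n-sum₄≡ᵇ4 true  true  true  true  = refl
b2n-sum₄≡ᵇ4 true  true  true  false = refl
b2n-sum₄≡ᵇ4 true  true  false true  = refl
b2n-sum₄≡ᵇ4 true  true  false false = refl
b2n-sum₄≡ᵇ4 true  false true  true  = refl
b2n-sum₄≡ᵇ4 true  false true  false = refl
b2n-sum₄≡ᵇ4 true  false false true  = refl
b2n-sum₄≡ᵇ4 true  false false false = refl
b2n-sum₄≡ᵇ4 false true  true  true  = refl
b2n-sum₄≡ᵇ4 false true  true  false = refl
b2n-sum₄≡ᵇ4 false true  false true  = refl
b2n-sum₄≡ᵇ4 false true  false false = refl
b2n-sum₄≡ᵇ4 false false true  true  = refl
b2n-sum₄≡ᵇ4 false false true  false = refl
b2n-sum₄≡ᵇ4 false false false true  = refl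
b2n-sum₄≡ᵇ4 false false false false = refl

b2n-sum₂≢4 : ∀ p q → (b2n p + b2n q ≡ᵇ 4) ≡ false
b2n-sum₂≢4 true  true  = refl
b2n-sum₂≢4 true  false = refl
b2n-sum₂≢4 false true  = refl
b2n-sum₂≢4 false false = refl

-- Columns are filled from the ground up, so a point is interior iff both cells above it exist.
square-full : ∀ s t y → (inColumn s y ∧ inColumn s (suc y) ∧ inColumn t y ∧ inColumn t (suc y))
                        ≡ (inColumn s (suc y) ∧ inColumn t (suc y))
square-full s t y with inColumn s (suc y) in s↑ | inColumn t (suc y) in t↑
... | false | _     = ∧-zeroʳ (inColumn s y)
... | true  | false rewrite inColumn-down s y s↑ = ∧-zeroʳ (inColumn t y)
... | true  | true  rewrite inColumn-down s y s↑ | inColumn-down t y t↑ = refl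

count-below-⊓ : ∀ M a b → a ≤ M → ∑[ y < M ] b2n ((suc y ≤ᵇ a) ∧ (suc y ≤ᵇ b)) ≡ a ⊓ b
count-below-⊓ M       zero    b       _         = sumBelow-vanishing M (λ _ _ → refl)
count-below-⊓ M       (suc a) zero    _         = sumBelow-vanishing M (λ y _ → cong b2n (∧-zeroʳ _))
count-below-⊓ (suc M) (suc a) (suc b) (s≤s a≤M) = cong suc (count-below-⊓ M a b a≤M)

count-rows : ∀ M s t → (∀ h → s ≡ just h → h ≤ M) →
             ∑[ y < M ] b2n (inColumn s (suc y) ∧ inColumn t (suc y)) ≡ minHeight s t
count-rows M (just a) (just b) bounded = count-below-⊓ M a b (bounded a refl)
count-rows M (just a) nothing  _       = sumBelow-vanishing M (λ y _ → cong b2n (∧-zeroʳ _))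
count-rows M nothing  t        _       = sumBelow-vanishing M (λ _ _ → refl)

lookupW≤sum : ∀ w c {h} → lookupW w c ≡ just h → h ≤ sum w
lookupW≤sum (a ∷ w) zero    refl = m≤m+n a (sum w)
lookupW≤sum (a ∷ w) (suc c) eq   = ≤-trans (lookupW≤sum w c eq) (m≤n+m (sum w) a)

interior-on-line : ∀ w x → ∑[ y < suc (suc (sum w)) ] b2n (cellsAt w (suc x) y ≡ᵇ 4)
                           ≡ minHeight (lookupW w x) (lookupW w (suc x))
interior-on-line w x = begin
    b2n (b2n (isCell w x 0) + b2n (isCell w (suc x) 0) ≡ᵇ 4)
      + ∑[ y < suc (sum w) ] b2n (cellsAt w (suc x) (suc y) ≡ᵇ 4)
  ≡⟨ cong (λ b → b2n b + ∑[ y < suc (sum w) ] b2n (cellsAt w (suc x) (suc y) ≡ᵇ 4))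
          (b2n-sum₂≢4 (isCell w x 0) (isCell w (suc x) 0)) ⟩
    ∑[ y < suc (sum w) ] b2n (cellsAt w (suc x) (suc y) ≡ᵇ 4)
  ≡⟨ sumBelow-cong (suc (sum w)) (λ y _ → cong b2n (full-square y)) ⟩
    ∑[ y < suc (sum w) ] b2n (inColumn s (suc y) ∧ inColumn t (suc y))
  ≡⟨ count-rows (suc (sum w)) s t (λ h eq → ≤-trans (lookupW≤sum w x eq) (n≤1+n (sum w))) ⟩
    minHeight s t
  ∎
  where
  open ≡-Reasoning
  s = lookupW w x
  t = lookupW w (suc x)
  full-square : ∀ y → (cellsAt w (suc x) (suc y) ≡ᵇ 4) ≡ (inColumn s (suc y) ∧ inColumn t (suc y))
  full-square y = begin
      (cellsAt w (suc x) (suc y) ≡ᵇ 4)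
    ≡⟨ b2n-sum₄≡ᵇ4 (isCell w x y) (isCell w x (suc y)) (isCell w (suc x) y) (isCell w (suc x) (suc y)) ⟩
      isCell w x y ∧ isCell w x (suc y) ∧ isCell w (suc x) y ∧ isCell w (suc x) (suc y)
    ≡⟨ cong₂ _∧_ (isCell≡inColumn w x y) (cong₂ _∧_ (isCell≡inColumn w x (suc y))
         (cong₂ _∧_ (isCell≡inColumn w (suc x) y) (isCell≡inColumn w (suc x) (suc y)))) ⟩
      inColumn s y ∧ inColumn s (suc y) ∧ inColumn t y ∧ inColumn t (suc y)
    ≡⟨ square-full s t y ⟩
      inColumn s (suc y) ∧ inColumn t (suc y)
    ∎

minHeight-sum≡minSum : ∀ w → ∑[ x < length w ] minHeight (lookupW w x) (lookupW w (suc x)) ≡ minSum w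
minHeight-sum≡minSum []          = refl
minHeight-sum≡minSum (a ∷ [])    = refl
minHeight-sum≡minSum (a ∷ b ∷ r) = cong (a ⊓ b +_) (minHeight-sum≡minSum (b ∷ r))

inter≡minSum : ∀ w → inter w ≡ minSum w
inter≡minSum w = begin
    inter w
  ≡⟨ length-filterᵇ (λ p → cellsAt w (proj₁ p) (proj₂ p) ≡ᵇ 4) (latticeBox w) ⟩
    sum (map interior (latticeBox w))
  ≡⟨ sum-map-concatMap interior (λ x → map (x ,_) (upTo M)) (upTo (suc (length w))) ⟩
    sum (map (λ x → sum (map interior (map (x ,_) (upTo M)))) (upTo (suc (length w))))
  ≡⟨ sum-map-applyUpTo (suc (length w)) id (λ x → sum (map interior (map (x ,_) (upTo M)))) ⟩
    ∑[ x < suc (length w) ] sum (map interior (map (x ,_) (upTo M)))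
  ≡⟨ sumBelow-cong (suc (length w)) (λ x _ → trans (cong sum (sym (map-∘ {g = interior} {f = x ,_} (upTo M))))
                                                    (sum-map-applyUpTo M id (λ y → interior (x , y)))) ⟩
    ∑[ x < suc (length w) ] ∑[ y < M ] interior (x , y)
  ≡⟨ cong (_+ ∑[ x < length w ] ∑[ y < M ] interior (suc x , y))
          (sumBelow-vanishing M (λ y _ → cong b2n (left-border y))) ⟩
    ∑[ x < length w ] ∑[ y < M ] interior (suc x , y)
  ≡⟨ sumBelow-cong (length w) (λ x _ → interior-on-line w x) ⟩
    ∑[ x < length w ] minHeight (lookupW w x) (lookupW w (suc x))
  ≡⟨ minHeight-sum≡minSum w ⟩
    minSum w
  ∎
  where
  open ≡-Reasoning
  M = suc (suc (sum w))
  interior : ℕ × ℕ → ℕ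
  interior (x , y) = b2n (cellsAt w x y ≡ᵇ 4)
  left-border : ∀ y → (cellsAt w 0 y ≡ᵇ 4) ≡ false
  left-border zero    with isCell w 0 0
  ... | true  = refl
  ... | false = refl
  left-border (suc y) = b2n-sum₂≢4 (isCell w 0 y) _


-- Words of C^≥ by final height

last∷ : ℕ → Word → ℕ
last∷ p []      = p
last∷ p (a ∷ r) = last∷ a r

endsAt : ℕ → Word → Bool
endsAt i []      = false
endsAt i (a ∷ r) = last∷ a r ≡ᵇ i

endsAtHeight : ℕ → Word → Bool
endsAtHeight zero    []      = true
endsAtHeight zero    (_ ∷ _) = false
endsAtHeight (suc i) w       = inCGG w ∧ endsAt i w

inBε : Word → Bool
inBε []      = true
inBε (a ∷ r) = inB (a ∷ r)

isBlock : ℕ → Word → Bool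
isBlock i y = all (i ≤ᵇ_) y ∧ endsAtHeight 1 (map (_∸ i) y)

record Ending (i a : ℕ) (r : Word) : Set where
  field
    starts0 : a ≡ 0
    steps   : stepsOK a r ≡ true
    avoids  : avoidsGG (a ∷ r) ≡ true
    ends    : last∷ a r ≡ i

endsAtHeight⇒Ending : ∀ i a r → endsAtHeight (suc i) (a ∷ r) ≡ true → Ending i a r
endsAtHeight⇒Ending i a r h = record
  { starts0 = dec-witness (a ≟ 0) (proj₁ catalan)
  ; steps   = proj₂ catalan
  ; avoids  = proj₂ inC
  ; ends    = dec-witness (last∷ a r ≟ i) (proj₂ parts)
  }
  where
  parts   = ∧-elim (inCGG (a ∷ r)) h
  inC     = ∧-elim (isCatalan (a ∷ r)) (proj₁ parts)
  catalan = ∧-elim (a ≡ᵇ 0) (proj₁ inC)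

Ending⇒endsAtHeight : ∀ i a r → Ending i a r → endsAtHeight (suc i) (a ∷ r) ≡ true
Ending⇒endsAtHeight i a r e =
  ∧-intro (∧-intro (∧-intro (dec-true (a ≟ 0) starts0) steps) avoids) (dec-true (last∷ a r ≟ i) ends)
  where open Ending e

last∷-++ : ∀ p x b y → last∷ p (x ++ b ∷ y) ≡ last∷ b y
last∷-++ p []      b y = refl
last∷-++ p (a ∷ x) b y = last∷-++ a x b y

last∷-map+ : ∀ i p r → last∷ (p + i) (map (_+ i) r) ≡ last∷ p r + i
last∷-map+ i p []      = refl
last∷-map+ i p (b ∷ r) = last∷-map+ i b r

endsAt-∷ʳ : ∀ i u a → endsAt i (u ∷ʳ a) ≡ (a ≡ᵇ i)
endsAt-∷ʳ i []      a = refl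
endsAt-∷ʳ i (b ∷ u) a = cong (_≡ᵇ i) (last∷-++ b u a [])

All-last∷ : ∀ {P : ℕ → Set} p r → All P (p ∷ r) → P (last∷ p r)
All-last∷ p []      (Pp ∷ _)  = Pp
All-last∷ p (b ∷ r) (_ ∷ Pbr) = All-last∷ b r Pbr

stepsOK-++ : ∀ p x y → stepsOK p (x ++ y) ≡ stepsOK p x ∧ stepsOK (last∷ p x) y
stepsOK-++ p []      y = refl
stepsOK-++ p (b ∷ x) y = trans (cong ((b ≤ᵇ suc p) ∧_) (stepsOK-++ b x y)) (sym (∧-assoc (b ≤ᵇ suc p) _ _))

stepsOK-++⁻ : ∀ p x y → stepsOK p (x ++ y) ≡ true → stepsOK p x ≡ true × stepsOK (last∷ p x) y ≡ true
stepsOK-++⁻ p x y h = ∧-elim (stepsOK p x) (trans (sym (stepsOK-++ p x y)) h)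

stepsOK-map+ : ∀ i p r → stepsOK (p + i) (map (_+ i) r) ≡ stepsOK p r
stepsOK-map+ i p []      = refl
stepsOK-map+ i p (b ∷ r) = cong₂ _∧_ (≤ᵇ-+ʳ b (suc p) i) (stepsOK-map+ i b r)

stepsOK-∷ʳ0 : ∀ p r → stepsOK p (r ∷ʳ 0) ≡ stepsOK p r
stepsOK-∷ʳ0 p []      = refl
stepsOK-∷ʳ0 p (b ∷ r) = cong ((b ≤ᵇ suc p) ∧_) (stepsOK-∷ʳ0 b r)

avoidsGG-map+ : ∀ i u → avoidsGG (map (_+ i) u) ≡ avoidsGG u
avoidsGG-map+ i []              = refl
avoidsGG-map+ i (a ∷ [])        = refl
avoidsGG-map+ i (a ∷ b ∷ [])    = refl
avoidsGG-map+ i (a ∷ b ∷ c ∷ r) =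
  cong₂ _∧_ (cong not (cong₂ _∧_ (≤ᵇ-+ʳ b a i) (≤ᵇ-+ʳ c b i))) (avoidsGG-map+ i (b ∷ c ∷ r))

avoidsGG-∷ʳ0 : ∀ u → avoidsGG (u ∷ʳ 0) ≡ avoidsGG u ∧ not (endsWeakDescent u)
avoidsGG-∷ʳ0 []              = refl
avoidsGG-∷ʳ0 (a ∷ [])        = refl
avoidsGG-∷ʳ0 (a ∷ b ∷ [])    = trans (∧-identityʳ _) (cong not (∧-identityʳ (b ≤ᵇ a)))
avoidsGG-∷ʳ0 (a ∷ b ∷ c ∷ r) =
  trans (cong (not ((b ≤ᵇ a) ∧ (c ≤ᵇ b)) ∧_) (avoidsGG-∷ʳ0 (b ∷ c ∷ r)))
        (sym (∧-assoc (not ((b ≤ᵇ a) ∧ (c ≤ᵇ b))) (avoidsGG (b ∷ c ∷ r))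
                      (not (endsWeakDescent (b ∷ c ∷ r)))))

avoidsGG-∷⁻ : ∀ a r → avoidsGG (a ∷ r) ≡ true → avoidsGG r ≡ true
avoidsGG-∷⁻ a []          _ = refl
avoidsGG-∷⁻ a (b ∷ [])    _ = refl
avoidsGG-∷⁻ a (b ∷ c ∷ r) h = proj₂ (∧-elim (not ((b ≤ᵇ a) ∧ (c ≤ᵇ b))) h)

avoidsGG-++⁻ˡ : ∀ x y → avoidsGG (x ++ y) ≡ true → avoidsGG x ≡ true
avoidsGG-++⁻ˡ []              y _ = refl
avoidsGG-++⁻ˡ (a ∷ [])        y _ = refl
avoidsGG-++⁻ˡ (a ∷ b ∷ [])    y _ = refl
avoidsGG-++⁻ˡ (a ∷ b ∷ c ∷ r) y h =
  ∧-intro (proj₁ parts) (avoidsGG-++⁻ˡ (b ∷ c ∷ r) y (proj₂ parts))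
  where parts = ∧-elim (not ((b ≤ᵇ a) ∧ (c ≤ᵇ b))) h

avoidsGG-++⁻ʳ : ∀ x y → avoidsGG (x ++ y) ≡ true → avoidsGG y ≡ true
avoidsGG-++⁻ʳ []      y h = h
avoidsGG-++⁻ʳ (a ∷ x) y h = avoidsGG-++⁻ʳ x y (avoidsGG-∷⁻ a (x ++ y) h)

avoidsGG-++-ascent : ∀ a x b y → avoidsGG (a ∷ x) ≡ true → avoidsGG (b ∷ y) ≡ true → last∷ a x < b →
                     avoidsGG (a ∷ x ++ b ∷ y) ≡ true
avoidsGG-++-ascent a []           b []      _  _  _   = refl
avoidsGG-++-ascent a []           b (c ∷ y) _  hb a<b rewrite dec-false (b ≤? a) (<⇒≱ a<b) = hb
avoidsGG-++-ascent a (a′ ∷ [])    b y       _  hb a′<b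
  rewrite dec-false (b ≤? a′) (<⇒≱ a′<b) | ∧-zeroʳ (a′ ≤ᵇ a) = avoidsGG-++-ascent a′ [] b y refl hb a′<b
avoidsGG-++-ascent a (a′ ∷ a″ ∷ x) b y       ha hb lt =
  ∧-intro (proj₁ parts) (avoidsGG-++-ascent a′ (a″ ∷ x) b y (proj₂ parts) hb lt)
  where parts = ∧-elim (not ((a′ ≤ᵇ a) ∧ (a″ ≤ᵇ a′))) ha

minSumFrom-++ : ∀ p x y → minSumFrom p (x ++ y) ≡ minSumFrom p x + minSumFrom (last∷ p x) y
minSumFrom-++ p []      y = refl
minSumFrom-++ p (b ∷ x) y = trans (cong (p ⊓ b +_) (minSumFrom-++ b x y)) (sym (+-assoc (p ⊓ b) _ _))

minSumFrom-map+ : ∀ i p r → minSumFrom (p + i) (map (_+ i) r) ≡ minSumFrom p r + i * length r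
minSumFrom-map+ i p []      = sym (*-zeroʳ i)
minSumFrom-map+ i p (b ∷ r) rewrite sym (+-distribʳ-⊓ i p b) | minSumFrom-map+ i b r =
  solve 4 (λ m i s l → m :+ i :+ (s :+ i :* l) := m :+ s :+ i :* (con 1 :+ l)) refl (p ⊓ b) i (minSumFrom b r) (length r)

minSum-map+ : ∀ i v → minSum (map (_+ i) v) ≡ minSum v + i * (length v ∸ 1)
minSum-map+ i []      = sym (*-zeroʳ i)
minSum-map+ i (a ∷ r) = minSumFrom-map+ i a r

minSum-∷ʳ0 : ∀ u → minSum (u ∷ʳ 0) ≡ minSum u
minSum-∷ʳ0 []      = refl
minSum-∷ʳ0 (a ∷ r) = go a r
  where
  go : ∀ p r → minSumFrom p (r ∷ʳ 0) ≡ minSumFrom p r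
  go p []      = cong (_+ 0) (⊓-zeroʳ p)
  go p (b ∷ r) = cong (p ⊓ b +_) (go b r)

endsAtHeight-∷ʳ≢ : ∀ i u a → a ≢ i → endsAtHeight (suc i) (u ∷ʳ a) ≡ false
endsAtHeight-∷ʳ≢ i u a a≢i =
  trans (cong (inCGG (u ∷ʳ a) ∧_) (trans (endsAt-∷ʳ i u a) (dec-false (a ≟ i) a≢i))) (∧-zeroʳ _)

endsAtHeight1-∷ʳ0 : ∀ u → endsAtHeight 1 (u ∷ʳ 0) ≡ inBε u
endsAtHeight1-∷ʳ0 []      = refl
endsAtHeight1-∷ʳ0 (a ∷ r) = begin
    inCGG ((a ∷ r) ∷ʳ 0) ∧ endsAt 0 ((a ∷ r) ∷ʳ 0)
  ≡⟨ cong (inCGG ((a ∷ r) ∷ʳ 0) ∧_) (endsAt-∷ʳ 0 (a ∷ r) 0) ⟩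
    inCGG ((a ∷ r) ∷ʳ 0) ∧ true
  ≡⟨ ∧-identityʳ _ ⟩
    ((a ≡ᵇ 0) ∧ stepsOK a (r ∷ʳ 0)) ∧ avoidsGG ((a ∷ r) ∷ʳ 0)
  ≡⟨ cong₂ _∧_ (cong ((a ≡ᵇ 0) ∧_) (stepsOK-∷ʳ0 a r)) (avoidsGG-∷ʳ0 (a ∷ r)) ⟩
    isCatalan (a ∷ r) ∧ (avoidsGG (a ∷ r) ∧ not (endsWeakDescent (a ∷ r)))
  ≡⟨ sym (∧-assoc (isCatalan (a ∷ r)) (avoidsGG (a ∷ r)) _) ⟩
    inB (a ∷ r)
  ∎
  where open ≡-Reasoning

All-map+ : ∀ i v → All (i ≤_) (map (_+ i) v)
All-map+ i []      = []
All-map+ i (a ∷ v) = m≤n+m i a ∷ All-map+ i v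

all-≤ᵇ-map+ : ∀ i v → all (i ≤ᵇ_) (map (_+ i) v) ≡ true
all-≤ᵇ-map+ i []      = refl
all-≤ᵇ-map+ i (a ∷ v) = ∧-intro (dec-true (i ≤? a + i) (m≤n+m i a)) (all-≤ᵇ-map+ i v)

all-≤ᵇ⇒All : ∀ i y → all (i ≤ᵇ_) y ≡ true → All (i ≤_) y
all-≤ᵇ⇒All i []      _ = []
all-≤ᵇ⇒All i (a ∷ y) h = dec-witness (i ≤? a) (proj₁ parts) ∷ all-≤ᵇ⇒All i y (proj₂ parts)
  where parts = ∧-elim (i ≤ᵇ a) h

map∸-map+ : ∀ i v → map (_∸ i) (map (_+ i) v) ≡ v
map∸-map+ i []      = refl
map∸-map+ i (a ∷ v) = cong₂ _∷_ (m+n∸n≡m a i) (map∸-map+ i v)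

map+-map∸ : ∀ i y → All (i ≤_) y → map (_+ i) (map (_∸ i) y) ≡ y
map+-map∸ i []      []          = refl
map+-map∸ i (a ∷ y) (i≤a ∷ i≤y) = cong₂ _∷_ (m∸n+n≡m i≤a) (map+-map∸ i y i≤y)

map+0 : ∀ v → map (_+ 0) v ≡ v
map+0 v = trans (map-cong +-identityʳ v) (map-id v)

isBlock-map+ : ∀ i v → isBlock i (map (_+ i) v) ≡ endsAtHeight 1 v
isBlock-map+ i v = cong₂ _∧_ (all-≤ᵇ-map+ i v) (cong (endsAtHeight 1) (map∸-map+ i v))

isBlock⇒All : ∀ i y → isBlock i y ≡ true → All (i ≤_) y
isBlock⇒All i y h = all-≤ᵇ⇒All i y (proj₁ (∧-elim (all (i ≤ᵇ_) y) h))

isBlock⇒map+ : ∀ i y → isBlock i y ≡ true →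
               y ≡ map (_+ i) (map (_∸ i) y) × endsAtHeight 1 (map (_∸ i) y) ≡ true
isBlock⇒map+ i y h = sym (map+-map∸ i y (isBlock⇒All i y h)) , proj₂ (∧-elim (all (i ≤ᵇ_) y) h)

glue : ∀ i x v → endsAtHeight i x ≡ true → endsAtHeight 1 v ≡ true →
       endsAtHeight (suc i) (x ++ map (_+ i) v) ≡ true
glue zero    []      v       _  hv = subst (λ y → endsAtHeight 1 y ≡ true) (sym (map+0 v)) hv
glue (suc j) (a ∷ r) (b ∷ v) hx hv with refl ← Ending.starts0 (endsAtHeight⇒Ending 0 b v hv) =
  Ending⇒endsAtHeight (suc j) a (r ++ suc j ∷ t) record
    { starts0 = starts0
    ; steps   = trans (stepsOK-++ a r (suc j ∷ t))
                      (∧-intro steps (subst (λ c → stepsOK c (suc j ∷ t) ≡ true) (sym ends)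
                         (∧-intro (dec-true (suc j ≤? suc j) ≤-refl)
                                  (trans (stepsOK-map+ (suc j) 0 v) (Ending.steps block)))))
    ; avoids  = avoidsGG-++-ascent a r (suc j) t avoids
                  (trans (avoidsGG-map+ (suc j) (0 ∷ v)) (Ending.avoids block)) (≤-reflexive (cong suc ends))
    ; ends    = trans (last∷-++ a r (suc j) t)
                      (trans (last∷-map+ (suc j) 0 v) (cong (_+ suc j) (Ending.ends block)))
    }
  where
  open Ending (endsAtHeight⇒Ending j a r hx)
  block = endsAtHeight⇒Ending 0 0 v hv
  t = map (_+ suc j) v

glue-minSum : ∀ i x v → endsAtHeight i x ≡ true → endsAtHeight 1 v ≡ true →
              minSum (x ++ map (_+ i) v) ≡ minSum x + (i ∸ 1) + minSum (map (_+ i) v)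
glue-minSum zero    []      v       _  _ = refl
glue-minSum (suc j) (a ∷ r) (b ∷ v) hx _ = begin
    minSumFrom a (r ++ b + suc j ∷ t)
  ≡⟨ minSumFrom-++ a r (b + suc j ∷ t) ⟩
    minSumFrom a r + (last∷ a r ⊓ (b + suc j) + minSumFrom (b + suc j) t)
  ≡⟨ cong (λ c → minSumFrom a r + (c ⊓ (b + suc j) + minSumFrom (b + suc j) t)) ends ⟩
    minSumFrom a r + (j ⊓ (b + suc j) + minSumFrom (b + suc j) t)
  ≡⟨ cong (λ m → minSumFrom a r + (m + minSumFrom (b + suc j) t))
          (m≤n⇒m⊓n≡m (≤-trans (n≤1+n j) (m≤n+m (suc j) b))) ⟩
    minSumFrom a r + (j + minSumFrom (b + suc j) t)
  ≡⟨ sym (+-assoc (minSumFrom a r) j _) ⟩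
    minSumFrom a r + j + minSumFrom (b + suc j) t
  ∎
  where
  open ≡-Reasoning
  open Ending (endsAtHeight⇒Ending j a r hx)
  t = map (_+ suc j) v

block-glue : ∀ i x y → endsAtHeight i x ≡ true → isBlock i y ≡ true → endsAtHeight (suc i) (x ++ y) ≡ true
block-glue i x y hx hy with isBlock⇒map+ i y hy
... | y≡ , hv = subst (λ z → endsAtHeight (suc i) (x ++ z) ≡ true) (sym y≡) (glue i x _ hx hv)

split-after-last-below : ∀ i w → All (i ≤_) w ⊎
  Σ[ p ∈ ℕ ] Σ[ x ∈ Word ] Σ[ y ∈ Word ] (w ≡ p ∷ x ++ y × last∷ p x < i × All (i ≤_) y)
split-after-last-below i []      = inj₁ []
split-after-last-below i (a ∷ w) with split-after-last-below i w
... | inj₂ (p , x , y , w≡ , c<i , i≤y) = inj₂ (a , p ∷ x , y , cong (a ∷_) w≡ , c<i , i≤y)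
... | inj₁ i≤w with a <? i
...   | yes a<i = inj₂ (a , [] , w , refl , a<i , i≤w)
...   | no  a≮i = inj₁ (≮⇒≥ a≮i ∷ i≤w)

cut-point : ∀ i p x d y → Ending i p (x ++ d ∷ y) → last∷ p x < i → i ≤ d → i ≡ suc (last∷ p x) × d ≡ i
cut-point i p x d y e c<i i≤d = i≡1+c , ≤-antisym (≤-trans d≤1+c (≤-reflexive (sym i≡1+c))) i≤d
  where
  d≤1+c : d ≤ suc (last∷ p x)
  d≤1+c = dec-witness (d ≤? suc (last∷ p x))
            (proj₁ (∧-elim (d ≤ᵇ suc (last∷ p x)) (proj₂ (stepsOK-++⁻ p x (d ∷ y) (Ending.steps e)))))
  i≡1+c : i ≡ suc (last∷ p x)
  i≡1+c = ≤-antisym (≤-trans i≤d d≤1+c) c<i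

shifted-block : ∀ i t → All (i ≤_) t → stepsOK i t ≡ true → avoidsGG (i ∷ t) ≡ true → last∷ i t ≡ i →
                endsAtHeight 1 (0 ∷ map (_∸ i) t) ≡ true
shifted-block i t i≤t steps avoids ends = Ending⇒endsAtHeight 0 0 (map (_∸ i) t) record
  { starts0 = refl
  ; steps   = trans (sym (stepsOK-map+ i 0 (map (_∸ i) t))) (subst (λ z → stepsOK i z ≡ true) (sym t≡) steps)
  ; avoids  = trans (sym (avoidsGG-map+ i (0 ∷ map (_∸ i) t)))
                    (subst (λ z → avoidsGG (i ∷ z) ≡ true) (sym t≡) avoids)
  ; ends    = +-cancelʳ-≡ i _ 0 (trans (sym (last∷-map+ i 0 (map (_∸ i) t))) (trans (cong (last∷ i) t≡) ends))
  }
  where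
  t≡ : map (_+ i) (map (_∸ i) t) ≡ t
  t≡ = map+-map∸ i t i≤t

decompose : ∀ i w → endsAtHeight (suc i) w ≡ true →
            Σ[ x ∈ Word ] Σ[ v ∈ Word ]
              (w ≡ x ++ map (_+ i) v × endsAtHeight i x ≡ true × endsAtHeight 1 v ≡ true)
decompose i (a ∷ r) hw with split-after-last-below i (a ∷ r)
... | inj₁ (i≤a ∷ _)
  with refl ← n≤0⇒n≡0 (subst (i ≤_) (Ending.starts0 (endsAtHeight⇒Ending i a r hw)) i≤a) =
  [] , a ∷ r , sym (map+0 (a ∷ r)) , refl , hw
... | inj₂ (p , x , [] , refl , c<i , _) =
  ⊥-elim (<-irrefl (trans (cong (last∷ p) (sym (++-identityʳ x)))
                           (Ending.ends (endsAtHeight⇒Ending i p (x ++ []) hw))) c<i)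
... | inj₂ (p , x , d ∷ y , refl , c<i , i≤d ∷ i≤y)
  with cut-point i p x d y (endsAtHeight⇒Ending i p (x ++ d ∷ y) hw) c<i i≤d
...   | refl , refl =
  p ∷ x , 0 ∷ map (_∸ i) y , cong (λ z → p ∷ x ++ i ∷ z) (sym (map+-map∸ i y i≤y)) ,
  Ending⇒endsAtHeight (last∷ p x) p x record
    { starts0 = starts0 ; steps = proj₁ (stepsOK-++⁻ p x (i ∷ y) steps)
    ; avoids = avoidsGG-++⁻ˡ (p ∷ x) (i ∷ y) avoids ; ends = refl } ,
  shifted-block i y i≤y (proj₂ (∧-elim (i ≤ᵇ i) (proj₂ (stepsOK-++⁻ p x (i ∷ y) steps))))
                (avoidsGG-++⁻ʳ (p ∷ x) (i ∷ y) avoids) (trans (sym (last∷-++ p x i y)) ends)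
  where open Ending (endsAtHeight⇒Ending i p (x ++ i ∷ y) hw)

cut-unique : ∀ i p x p′ x′ y y′ → (p ∷ x) ++ y ≡ (p′ ∷ x′) ++ y′ →
             last∷ p x < i → last∷ p′ x′ < i → All (i ≤_) y → All (i ≤_) y′ → length x ≡ length x′
cut-unique i p []      p′ []        y y′ _  _   _    _   _    = refl
cut-unique i p []      p′ (b′ ∷ x′) y y′ eq _   c′<i i≤y _    =
  ⊥-elim (<⇒≱ c′<i (All-last∷ b′ x′ (++⁻ˡ (b′ ∷ x′)
    (subst (All (i ≤_)) (proj₂ (∷-injective eq)) i≤y))))
cut-unique i p (b ∷ x) p′ []        y y′ eq c<i _    _   i≤y′ =
  ⊥-elim (<⇒≱ c<i (All-last∷ b x (++⁻ˡ (b ∷ x)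
    (subst (All (i ≤_)) (sym (proj₂ (∷-injective eq))) i≤y′))))
cut-unique i p (b ∷ x) p′ (b′ ∷ x′) y y′ eq c<i c′<i i≤y i≤y′ =
  cong suc (cut-unique i b x b′ x′ y y′ (proj₂ (∷-injective eq)) c<i c′<i i≤y i≤y′)

decomposition-unique : ∀ i x x′ v v′ → endsAtHeight i x ≡ true → endsAtHeight i x′ ≡ true →
                       x ++ map (_+ i) v ≡ x′ ++ map (_+ i) v′ → length x ≡ length x′
decomposition-unique zero    []      []        v v′ _  _   _  = refl
decomposition-unique (suc j) (a ∷ r) (a′ ∷ r′) v v′ hx hx′ eq =
  cong suc (cut-unique (suc j) a r a′ r′ _ _ eq (below a r hx) (below a′ r′ hx′)
                       (All-map+ (suc j) v) (All-map+ (suc j) v′))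
  where
  below : ∀ a r → endsAtHeight (suc j) (a ∷ r) ≡ true → last∷ a r < suc j
  below a r h = ≤-reflexive (cong suc (Ending.ends (endsAtHeight⇒Ending j a r h)))

stepsOK⇒bounded : ∀ p r → stepsOK p r ≡ true → All (_≤ p + length r) r
stepsOK⇒bounded p []      _ = []
stepsOK⇒bounded p (b ∷ r) h =
  ≤-trans b≤1+p (≤-trans (s≤s (m≤m+n p (length r))) suc-inside) ∷
  All.map (λ c≤ → ≤-trans c≤ (≤-trans (+-monoˡ-≤ (length r) b≤1+p) suc-inside))
          (stepsOK⇒bounded b r (proj₂ parts))
  where
  parts = ∧-elim (b ≤ᵇ suc p) h
  b≤1+p = dec-witness (b ≤? suc p) (proj₁ parts)
  suc-inside : suc p + length r ≤ p + suc (length r)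
  suc-inside = ≤-reflexive (sym (+-suc p (length r)))

letters<length : ∀ w → inCGG w ≡ true → All (_< length w) w
letters<length []      _ = []
letters<length (a ∷ r) h
  with refl ← dec-witness (a ≟ 0) (proj₁ (∧-elim (a ≡ᵇ 0) (proj₁ (∧-elim (isCatalan (a ∷ r)) h)))) =
  z<s ∷ All.map s≤s (stepsOK⇒bounded 0 r (proj₁ (∧-elim (isCatalan (0 ∷ r)) h)))

endsAtHeight⇒≤length : ∀ i x → endsAtHeight i x ≡ true → i ≤ length x
endsAtHeight⇒≤length zero    x       _ = z≤n
endsAtHeight⇒≤length (suc j) (a ∷ r) h =
  subst (_< length (a ∷ r)) (Ending.ends (endsAtHeight⇒Ending j a r h))
        (All-last∷ a r (letters<length (a ∷ r) (proj₁ (∧-elim (inCGG (a ∷ r)) h))))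

minInter : ℕ → ℕ
minInter zero    = 0
minInter (suc i) = minInter i + (i ∸ 1)

minInter≤minSum : ∀ i w → endsAtHeight i w ≡ true → minInter i ≤ minSum w
minInter≤minSum zero    w h = z≤n
minInter≤minSum (suc i) w h with decompose i w h
... | x , v , refl , hx , hv = begin
    minInter i + (i ∸ 1)
  ≤⟨ +-monoˡ-≤ (i ∸ 1) (minInter≤minSum i x hx) ⟩
    minSum x + (i ∸ 1)
  ≤⟨ m≤m+n _ _ ⟩
    minSum x + (i ∸ 1) + minSum (map (_+ i) v)
  ≡⟨ glue-minSum i x v hx hv ⟨
    minSum (x ++ map (_+ i) v)
  ∎
  where open ≤-Reasoning

minInter-closed : ∀ i → ((i ∸ 2) * (i ∸ 1)) / 2 ≡ minInter i
minInter-closed zero          = refl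
minInter-closed (suc zero)    = refl
minInter-closed (suc (suc j)) = trans (cong (_/ 2) (sym (twice j))) (m*n/n≡m (minInter (suc (suc j))) 2)
  where
  twice : ∀ j → minInter (suc (suc j)) * 2 ≡ j * suc j
  twice zero    = refl
  twice (suc j) rewrite *-distribʳ-+ 2 (minInter (suc (suc j))) (suc j) | twice j =
    solve 1 (λ j → j :* (con 1 :+ j) :+ (con 1 :+ j) :* con 2 := (con 1 :+ j) :* (con 2 :+ j)) refl j


-- Coefficients of the series

factor : ℕ → FPS
factor j = oneS ⊕ substXQ j H

heightInter : ℕ → ℕ → Word → ℕ
heightInter i k w = b2n (endsAtHeight i w) * b2n (minSum w ≡ᵇ k)

substXQ-H : ∀ i c d → substXQ i H (suc c) d ≡
            sumWords (suc c) (suc c) (λ u → b2n (inBε u) * b2n (minSum u + i * suc c ≡ᵇ d))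
substXQ-H i c d with i * suc c ≤ᵇ d | ≤ᵇ-reflects-≤ (i * suc c) d
... | true  | ofʸ X≤d = trans (countWords≡sumWords inB (suc c) (d ∸ i * suc c))
                              (sumWords-cong (suc c) (suc c) {λ u → b2n (inB u) * b2n (inter u ≡ᵇ d ∸ i * suc c)}
                                                            {λ u → b2n (inBε u) * b2n (minSum u + i * suc c ≡ᵇ d)}
                                 λ { (a ∷ r) _ → cong (b2n (inB (a ∷ r)) *_) (cong b2n (weight (a ∷ r))) })
  where
  weight : ∀ u → (inter u ≡ᵇ d ∸ i * suc c) ≡ (minSum u + i * suc c ≡ᵇ d)
  weight u rewrite inter≡minSum u = does-⇔ (≡∸⇔+≡ X≤d) (minSum u ≟ d ∸ i * suc c) (minSum u + i * suc c ≟ d)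
... | false | ofⁿ X≰d = sym (sumWords-vanishing (suc c) (suc c) λ u _ →
        trans (cong (λ t → b2n (inBε u) * b2n t)
                    (dec-false (minSum u + i * suc c ≟ d) λ e → X≰d (≤-trans (m≤n+m _ _) (≤-reflexive e))))
              (*-zeroʳ (b2n (inBε u))))

factor-Bε : ∀ i c d m → c ≤ m →
            factor i c d ≡ sumWords c m (λ u → b2n (inBε u) * b2n (minSum u + i * c ≡ᵇ d))
factor-Bε i zero    zero    m _   rewrite *-zeroʳ i = refl
factor-Bε i zero    (suc d) m _   rewrite *-zeroʳ i = refl
factor-Bε i (suc c) d       m c<m = trans (substXQ-H i c d) (sumWords-alphabet (suc c) _ c<m outside)
  where
  outside : ∀ u → IsWord (suc c) m u → ¬ All (_< suc c) u →
            b2n (inBε u) * b2n (minSum u + i * suc c ≡ᵇ d) ≡ 0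
  outside (a ∷ r) (len , _) unbounded with inB (a ∷ r) in inB≡
  ... | false = refl
  ... | true  = ⊥-elim (unbounded (subst (λ l → All (_< l) (a ∷ r)) len
                  (letters<length (a ∷ r) (proj₁ (∧-elim (inCGG (a ∷ r)) inB≡)))))

factor-blocks : ∀ i c d m → i + suc c ≤ m →
                factor i c d ≡ sumWords (suc c) m (λ y → b2n (isBlock i y) * b2n (minSum y ≡ᵇ d))
factor-blocks i c d m i+1+c≤m = sym (begin
    sumWords (suc c) m block
  ≡⟨ cong (λ l → sumWords (suc c) l block) (sym (m+[n∸m]≡n i≤m)) ⟩
    sumWords (suc c) (i + m′) block
  ≡⟨ sumWords-shift (suc c) i m′ block below ⟩
    sumWords (suc c) m′ (block ∘ map (_+ i))
  ≡⟨ sumWords-cong (suc c) m′ (λ v (len , _) → cong₂ (λ b s → b2n b * b2n (s ≡ᵇ d)) (isBlock-map+ i v)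
                                (trans (minSum-map+ i v) (cong (λ l → minSum v + i * (l ∸ 1)) len))) ⟩
    sumWords (suc c) m′ (λ v → b2n (endsAtHeight 1 v) * b2n (minSum v + i * c ≡ᵇ d))
  ≡⟨ sumWords-∷ʳ c m′ (λ v → b2n (endsAtHeight 1 v) * b2n (minSum v + i * c ≡ᵇ d)) ⟩
    ∑[ a < m′ ] sumWords c m′ (λ u → b2n (endsAtHeight 1 (u ∷ʳ a)) * b2n (minSum (u ∷ʳ a) + i * c ≡ᵇ d))
  ≡⟨ sumBelow-single m′ 0 _ 0<m′ (λ a _ a≢0 → sumWords-vanishing c m′ λ u _ →
       cong (λ b → b2n b * b2n (minSum (u ∷ʳ a) + i * c ≡ᵇ d)) (endsAtHeight-∷ʳ≢ 0 u a a≢0)) ⟩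
    sumWords c m′ (λ u → b2n (endsAtHeight 1 (u ∷ʳ 0)) * b2n (minSum (u ∷ʳ 0) + i * c ≡ᵇ d))
  ≡⟨ sumWords-cong c m′ (λ u _ → cong₂ (λ b s → b2n b * b2n (s + i * c ≡ᵇ d))
                                       (endsAtHeight1-∷ʳ0 u) (minSum-∷ʳ0 u)) ⟩
    sumWords c m′ (λ u → b2n (inBε u) * b2n (minSum u + i * c ≡ᵇ d))
  ≡⟨ factor-Bε i c d m′ (≤-trans (n≤1+n c) 1+c≤m′) ⟨
    factor i c d
  ∎)
  where
  open ≡-Reasoning
  m′ = m ∸ i
  i≤m : i ≤ m
  i≤m = ≤-trans (m≤m+n i (suc c)) i+1+c≤m
  1+c≤m′ : suc c ≤ m′
  1+c≤m′ = subst (_≤ m′) (m+n∸m≡n i (suc c)) (∸-monoˡ-≤ i i+1+c≤m)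
  0<m′ : 0 < m′
  0<m′ = ≤-trans (s≤s z≤n) 1+c≤m′
  block : Word → ℕ
  block y = b2n (isBlock i y) * b2n (minSum y ≡ᵇ d)
  below : ∀ y → ¬ All (i ≤_) y → block y ≡ 0
  below y ¬above with isBlock i y in h
  ... | false = refl
  ... | true  = ⊥-elim (¬above (isBlock⇒All i y h))

⊛≡sumBelow : ∀ (f g : FPS) n k → (f ⊛ g) n k ≡ ∑[ a < suc n ] ∑[ b < suc k ] (f a b * g (n ∸ a) (k ∸ b))
⊛≡sumBelow f g n k =
  trans (Σ≤≡sumBelow n _) (sumBelow-cong (suc n) (λ a _ → Σ≤≡sumBelow k (λ b → f a b * g (n ∸ a) (k ∸ b))))

splitTerm : ℕ → ℕ → Word → Word → ℕ
splitTerm i k x y = b2n (endsAtHeight i x ∧ isBlock i y) * b2n (minSum x + minSum y ≡ᵇ k + minInter i)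

collapse-weights : ∀ i k x y →
  ∑[ b < suc k ] (heightInter i (b + minInter i) x * (b2n (isBlock i y) * b2n (minSum y ≡ᵇ k ∸ b)))
  ≡ splitTerm i k x y
collapse-weights i k x y with endsAtHeight i x in hx
... | false = sumBelow-vanishing (suc k) (λ _ _ → refl)
... | true  = begin
    ∑[ b < suc k ] ((1 * b2n (minSum x ≡ᵇ b + E)) * (b2n (isBlock i y) * b2n (minSum y ≡ᵇ k ∸ b)))
  ≡⟨ sumBelow-cong (suc k) (λ b _ → solve 3 (λ p q r → (con 1 :* p) :* (q :* r) := q :* (p :* r)) refl
                                      (b2n (minSum x ≡ᵇ b + E)) (b2n (isBlock i y)) (b2n (minSum y ≡ᵇ k ∸ b))) ⟩
    ∑[ b < suc k ] (b2n (isBlock i y) * (b2n (minSum x ≡ᵇ b + E) * b2n (minSum y ≡ᵇ k ∸ b)))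
  ≡⟨ sumBelow-*ˡ (suc k) (b2n (isBlock i y)) (λ b → b2n (minSum x ≡ᵇ b + E) * b2n (minSum y ≡ᵇ k ∸ b)) ⟩
    b2n (isBlock i y) * ∑[ b < suc k ] (b2n (minSum x ≡ᵇ b + E) * b2n (minSum y ≡ᵇ k ∸ b))
  ≡⟨ cong (b2n (isBlock i y) *_) (convolve-shifted (minSum x) (minSum y) E k (minInter≤minSum i x hx)) ⟩
    b2n (isBlock i y) * b2n (minSum x + minSum y ≡ᵇ k + E)
  ∎
  where
  open ≡-Reasoning
  E = minInter i

splitTerm-vanishing : ∀ i k x y → (endsAtHeight i x ≡ true → isBlock i y ≡ true → ⊥) → splitTerm i k x y ≡ 0
splitTerm-vanishing i k x y ¬split with endsAtHeight i x | isBlock i y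
... | false | _     = refl
... | true  | false = refl
... | true  | true  = ⊥-elim (¬split refl refl)

splitTerm-at-glue : ∀ i k x v → endsAtHeight i x ≡ true → endsAtHeight 1 v ≡ true →
                splitTerm i k x (map (_+ i) v) ≡ 1 * b2n (minSum (x ++ map (_+ i) v) ≡ᵇ k + minInter (suc i))
splitTerm-at-glue i k x v hx hv rewrite hx | isBlock-map+ i v | hv | glue-minSum i x v hx hv =
  cong (λ t → 1 * b2n t) (trans (sym (≡ᵇ-+ʳ (minSum x + minSum (map (_+ i) v)) (k + minInter i) (i ∸ 1)))
    (cong₂ _≡ᵇ_ (solve 3 (λ a b j → a :+ b :+ j := a :+ j :+ b) refl (minSum x) (minSum (map (_+ i) v)) (i ∸ 1))
                (+-assoc k (minInter i) (i ∸ 1))))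

decomposition-point : ∀ i n x v → endsAtHeight 1 v ≡ true → length (x ++ map (_+ i) v) ≡ n + suc i →
                      length x ∸ i ≤ n
decomposition-point i n x v hv len = begin
    length x ∸ i                      ≤⟨ ∸-monoˡ-≤ i (≤-pred (begin
      suc (length x)                    ≡⟨ +-comm 1 (length x) ⟩
      length x + 1                      ≤⟨ +-monoʳ-≤ (length x) (endsAtHeight⇒≤length 1 v hv) ⟩
      length x + length v               ≡⟨ cong (length x +_) (length-map (_+ i) v) ⟨
      length x + length (map (_+ i) v)  ≡⟨ trans (sym (length-++ x)) len ⟩
      n + suc i                         ≡⟨ +-suc n i ⟩
      suc (n + i)                       ∎)) ⟩
    n + i ∸ i                         ≡⟨ m+n∸n≡m n i ⟩
    n                                 ∎
  where open ≤-Reasoning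

splitTerm-elsewhere : ∀ i k a x v → endsAtHeight i x ≡ true →
  a + i ≤ length (x ++ map (_+ i) v) → a + i ≢ length x →
  splitTerm i k (take (a + i) (x ++ map (_+ i) v)) (drop (a + i) (x ++ map (_+ i) v)) ≡ 0
splitTerm-elsewhere i k a x v hx a+i≤ a+i≢ = splitTerm-vanishing i k x′ y′ λ hx′ hy′ →
  a+i≢ (trans (sym (trans (length-take (a + i) w) (m≤n⇒m⊓n≡m a+i≤)))
              (decomposition-unique i x′ x (map (_∸ i) y′) v hx′ hx
                 (trans (cong (x′ ++_) (sym (proj₁ (isBlock⇒map+ i y′ hy′)))) (take++drop≡id (a + i) w))))
  where
  w  = x ++ map (_+ i) v
  x′ = take (a + i) w
  y′ = drop (a + i) w

collapse-splits : ∀ i n k w → length w ≡ n + suc i →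
  ∑[ a < suc n ] splitTerm i k (take (a + i) w) (drop (a + i) w)
  ≡ heightInter (suc i) (k + minInter (suc i)) w
collapse-splits i n k w len with endsAtHeight (suc i) w in hw
... | false = sumBelow-vanishing (suc n) λ a _ → splitTerm-vanishing i k (take (a + i) w) (drop (a + i) w) λ hx hy →
  false≢true (trans (sym hw) (subst (λ z → endsAtHeight (suc i) z ≡ true) (take++drop≡id (a + i) w)
                                    (block-glue i (take (a + i) w) (drop (a + i) w) hx hy)))
  where
  false≢true : false ≢ true
  false≢true ()
... | true with decompose i w hw
...   | x , v , refl , hx , hv =
  trans (sumBelow-single (suc n) (length x ∸ i) (λ a → splitTerm i k (take (a + i) w) (drop (a + i) w))
                         (s≤s (decomposition-point i n x v hv len))
                         (λ a a<1+n a≢a₀ → splitTerm-elsewhere i k a x v hx (a+i≤ a a<1+n)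
                                             (λ e → a≢a₀ (trans (sym (m+n∸n≡m a i)) (cong (_∸ i) e)))))
        (trans (cong₂ (splitTerm i k) (trans (cong (λ l → take l w) a₀+i≡) (take-length-++ x (map (_+ i) v)))
                                      (trans (cong (λ l → drop l w) a₀+i≡) (drop-length-++ x (map (_+ i) v))))
               (splitTerm-at-glue i k x v hx hv))
  where
  a₀+i≡ : length x ∸ i + i ≡ length x
  a₀+i≡ = m∸n+n≡m (endsAtHeight⇒≤length i x hx)
  a+i≤ : ∀ a → a < suc n → a + i ≤ length w
  a+i≤ a a<1+n =
    ≤-trans (+-monoˡ-≤ i (≤-pred a<1+n)) (≤-trans (+-monoʳ-≤ n (n≤1+n i)) (≤-reflexive (sym len)))

oneS-coeff : ∀ n k m → oneS n k ≡ sumWords n m (heightInter 0 k)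
oneS-coeff zero    zero    m = refl
oneS-coeff zero    (suc k) m = refl
oneS-coeff (suc n) k       m =
  sym (sumWords-vanishing (suc n) m {heightInter 0 k} λ { (_ ∷ _) _ → refl })

prodS-coeff : ∀ i n k m → n + i ≤ m →
  prodS i factor n k ≡ sumWords (n + i) m (heightInter i (k + minInter i))
prodS-coeff zero    n k m _ rewrite +-identityʳ n | +-identityʳ k = oneS-coeff n k m
prodS-coeff (suc i) n k m n+1+i≤m = begin
    Σ≤ n (λ a → Σ≤ k (λ b → prodS i factor a b * factor i (n ∸ a) (k ∸ b)))
  ≡⟨ ⊛≡sumBelow (prodS i factor) (factor i) n k ⟩
    ∑[ a < suc n ] ∑[ b < suc k ] (prodS i factor a b * factor i (n ∸ a) (k ∸ b))
  ≡⟨ sumBelow-cong (suc n) (λ a a<1+n → sumBelow-cong (suc k) (λ b _ → term a b (≤-pred a<1+n))) ⟩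
    ∑[ a < suc n ] ∑[ b < suc k ] sumWords N m (G a b)
  ≡⟨ sumBelow-cong (suc n) (λ a _ → sumWords-sumBelow N m (suc k) (G a)) ⟨
    ∑[ a < suc n ] sumWords N m (λ w → ∑[ b < suc k ] G a b w)
  ≡⟨ sumWords-sumBelow N m (suc n) (λ a w → ∑[ b < suc k ] G a b w) ⟨
    sumWords N m (λ w → ∑[ a < suc n ] ∑[ b < suc k ] G a b w)
  ≡⟨ sumWords-cong N m (λ w _ → sumBelow-cong (suc n) λ a _ →
       collapse-weights i k (take (a + i) w) (drop (a + i) w)) ⟩
    sumWords N m (λ w → ∑[ a < suc n ] splitTerm i k (take (a + i) w) (drop (a + i) w))
  ≡⟨ sumWords-cong N m (λ w (len , _) → collapse-splits i n k w len) ⟩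
    sumWords N m (heightInter (suc i) (k + minInter (suc i)))
  ∎
  where
  open ≡-Reasoning
  N = n + suc i
  prefix : ℕ → Word → ℕ
  prefix b = heightInter i (b + minInter i)
  suffix : ℕ → Word → ℕ
  suffix d y = b2n (isBlock i y) * b2n (minSum y ≡ᵇ d)
  G : ℕ → ℕ → Word → ℕ
  G a b w = prefix b (take (a + i) w) * suffix (k ∸ b) (drop (a + i) w)
  i+1+n≤m : i + suc n ≤ m
  i+1+n≤m = ≤-trans (≤-reflexive (trans (+-comm i (suc n)) (sym (+-suc n i)))) n+1+i≤m
  term : ∀ a b → a ≤ n → prodS i factor a b * factor i (n ∸ a) (k ∸ b) ≡ sumWords N m (G a b)
  term a b a≤n =
    trans (cong₂ _*_ (prodS-coeff i a b m (≤-trans (+-monoˡ-≤ i a≤n) (≤-trans (+-monoʳ-≤ n (n≤1+n i)) n+1+i≤m)))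
                     (factor-blocks i (n ∸ a) (k ∸ b) m (≤-trans (+-monoʳ-≤ i (s≤s (m∸n≤m n a))) i+1+n≤m)))
          (sumWords-split-at a i n m (prefix b) (suffix (k ∸ b)) a≤n)

mono-⊛ : ∀ i E n k (P : FPS) → (mono i E ⊛ P) n k ≡ b2n (i ≤ᵇ n) * (b2n (E ≤ᵇ k) * P (n ∸ i) (k ∸ E))
mono-⊛ i E n k P = begin
    Σ≤ n (λ a → Σ≤ k (λ b → mono i E a b * P (n ∸ a) (k ∸ b)))
  ≡⟨ ⊛≡sumBelow (mono i E) P n k ⟩
    ∑[ a < suc n ] ∑[ b < suc k ] (b2n ((a ≡ᵇ i) ∧ (b ≡ᵇ E)) * P (n ∸ a) (k ∸ b))
  ≡⟨ sumBelow-cong (suc n) (λ a _ → trans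
       (sumBelow-cong (suc k) (λ b _ → trans (cong (_* P (n ∸ a) (k ∸ b)) (b2n-∧ (a ≡ᵇ i) (b ≡ᵇ E)))
                                             (*-assoc (b2n (a ≡ᵇ i)) (b2n (b ≡ᵇ E)) (P (n ∸ a) (k ∸ b)))))
       (sumBelow-*ˡ (suc k) (b2n (a ≡ᵇ i)) (λ b → b2n (b ≡ᵇ E) * P (n ∸ a) (k ∸ b)))) ⟩
    ∑[ a < suc n ] (b2n (a ≡ᵇ i) * ∑[ b < suc k ] (b2n (b ≡ᵇ E) * P (n ∸ a) (k ∸ b)))
  ≡⟨ sumBelow-cong (suc n) (λ a _ → cong (b2n (a ≡ᵇ i) *_) (sumBelow-δ k E (λ b → P (n ∸ a) (k ∸ b)))) ⟩
    ∑[ a < suc n ] (b2n (a ≡ᵇ i) * (b2n (E ≤ᵇ k) * P (n ∸ a) (k ∸ E)))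
  ≡⟨ sumBelow-δ n i (λ a → b2n (E ≤ᵇ k) * P (n ∸ a) (k ∸ E)) ⟩
    b2n (i ≤ᵇ n) * (b2n (E ≤ᵇ k) * P (n ∸ i) (k ∸ E))
  ∎
  where open ≡-Reasoning

heightInter-vanishing : ∀ j k w → (endsAtHeight j w ≡ true → minSum w ≢ k) → heightInter j k w ≡ 0
heightInter-vanishing j k w ¬counted with endsAtHeight j w
... | false = refl
... | true  = cong (λ t → 1 * b2n t) (dec-false (minSum w ≟ k) (¬counted refl))

rhsTerm-coeff : ∀ i n k → rhsTerm (suc i) n k ≡ sumWords n n (heightInter (suc i) k)
rhsTerm-coeff i n k = begin
    rhsTerm (suc i) n k
  ≡⟨ mono-⊛ (suc i) E′ n k (prodS (suc i) factor) ⟩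
    b2n (suc i ≤ᵇ n) * (b2n (E′ ≤ᵇ k) * prodS (suc i) factor (n ∸ suc i) (k ∸ E′))
  ≡⟨ cong (λ e → b2n (suc i ≤ᵇ n) * (b2n (e ≤ᵇ k) * prodS (suc i) factor (n ∸ suc i) (k ∸ e)))
          (minInter-closed (suc i)) ⟩
    b2n (suc i ≤ᵇ n) * (b2n (E ≤ᵇ k) * prodS (suc i) factor (n ∸ suc i) (k ∸ E))
  ≡⟨ by-cases ⟩
    sumWords n n (heightInter (suc i) k)
  ∎
  where
  open ≡-Reasoning
  E′ = ((suc i ∸ 2) * (suc i ∸ 1)) / 2
  E  = minInter (suc i)
  by-cases : b2n (suc i ≤ᵇ n) * (b2n (E ≤ᵇ k) * prodS (suc i) factor (n ∸ suc i) (k ∸ E))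
             ≡ sumWords n n (heightInter (suc i) k)
  by-cases with suc i ≤ᵇ n | ≤ᵇ-reflects-≤ (suc i) n | E ≤ᵇ k | ≤ᵇ-reflects-≤ E k
  ... | false | ofⁿ i≰n | _     | _        = sym (sumWords-vanishing n n λ w (len , _) →
        heightInter-vanishing (suc i) k w (λ h _ → i≰n (subst (suc i ≤_) len (endsAtHeight⇒≤length (suc i) w h))))
  ... | true  | ofʸ _   | false | ofⁿ E≰k = sym (sumWords-vanishing n n λ w _ →
        heightInter-vanishing (suc i) k w (λ h e → E≰k (subst (E ≤_) e (minInter≤minSum (suc i) w h))))
  ... | true  | ofʸ i≤n | true  | ofʸ E≤k = begin
      1 * (1 * prodS (suc i) factor (n ∸ suc i) (k ∸ E))
    ≡⟨ trans (*-identityˡ _) (*-identityˡ _) ⟩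
      prodS (suc i) factor (n ∸ suc i) (k ∸ E)
    ≡⟨ prodS-coeff (suc i) (n ∸ suc i) (k ∸ E) n (≤-reflexive (m∸n+n≡m i≤n)) ⟩
      sumWords (n ∸ suc i + suc i) n (heightInter (suc i) (k ∸ E + E))
    ≡⟨ cong₂ (λ l e → sumWords l n (heightInter (suc i) e))
             (m∸n+n≡m i≤n) (m∸n+n≡m E≤k) ⟩
      sumWords n n (heightInter (suc i) k)
    ∎

partialSum≡sumBelow : ∀ N (T : ℕ → FPS) n k → partialSum N T n k ≡ ∑[ j < N ] T (suc j) n k
partialSum≡sumBelow zero    T n k = refl
partialSum≡sumBelow (suc N) T n k =
  trans (cong (_+ T (suc N) n k) (partialSum≡sumBelow N T n k)) (sym (sumBelow-suc N (λ j → T (suc j) n k)))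

heights-sum : ∀ N a r → last∷ a r < N → ∑[ j < N ] b2n (endsAtHeight (suc j) (a ∷ r)) ≡ b2n (inCGG (a ∷ r))
heights-sum N a r ℓ<N =
  trans (sumBelow-single N ℓ (λ j → b2n (endsAtHeight (suc j) (a ∷ r))) ℓ<N λ j _ j≢ℓ →
           cong b2n (trans (cong (inCGG (a ∷ r) ∧_) (dec-false (ℓ ≟ j) (j≢ℓ ∘ sym))) (∧-zeroʳ _)))
        (cong b2n (trans (cong (inCGG (a ∷ r) ∧_) (dec-true (ℓ ≟ ℓ) refl)) (∧-identityʳ _)))
  where ℓ = last∷ a r

count-by-height : ∀ N n k w → suc n ≤ N → IsWord (suc n) (suc n) w →
  b2n (inCGG w) * b2n (inter w ≡ᵇ k) ≡ ∑[ j < N ] heightInter (suc j) k w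
count-by-height N n k (a ∷ r) n<N (_ , bounded) = begin
    b2n (inCGG (a ∷ r)) * b2n (inter (a ∷ r) ≡ᵇ k)
  ≡⟨ cong₂ (λ c t → c * b2n (t ≡ᵇ k)) (sym (heights-sum N a r (<-≤-trans (All-last∷ a r bounded) n<N)))
                                       (inter≡minSum (a ∷ r)) ⟩
    (∑[ j < N ] b2n (endsAtHeight (suc j) (a ∷ r))) * b2n (minSum (a ∷ r) ≡ᵇ k)
  ≡⟨ sumBelow-*ʳ N (b2n (minSum (a ∷ r) ≡ᵇ k)) (λ j → b2n (endsAtHeight (suc j) (a ∷ r))) ⟨
    ∑[ j < N ] heightInter (suc j) k (a ∷ r)
  ∎
  where open ≡-Reasoning

theorem5p3 : ∀ n k → ∃ λ N₀ → ∀ N → N ≥ N₀ → Cgeq n k ≡ partialSum N rhsTerm n k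
theorem5p3 zero    k = 0 , λ N _ →
  sym (trans (partialSum≡sumBelow N rhsTerm 0 k) (sumBelow-vanishing N λ j _ → rhsTerm-coeff j 0 k))
theorem5p3 (suc n) k = suc n , λ N n<N → begin
    Cgeq (suc n) k
  ≡⟨ countWords≡sumWords inCGG (suc n) k ⟩
    sumWords (suc n) (suc n) (λ w → b2n (inCGG w) * b2n (inter w ≡ᵇ k))
  ≡⟨ sumWords-cong (suc n) (suc n) (λ w → count-by-height N n k w n<N) ⟩
    sumWords (suc n) (suc n) (λ w → ∑[ j < N ] heightInter (suc j) k w)
  ≡⟨ sumWords-sumBelow (suc n) (suc n) N (λ j w → heightInter (suc j) k w) ⟩
    ∑[ j < N ] sumWords (suc n) (suc n) (heightInter (suc j) k)
  ≡⟨ sumBelow-cong N (λ j _ → rhsTerm-coeff j (suc n) k) ⟨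
    ∑[ j < N ] rhsTerm (suc j) (suc n) k
  ≡⟨ partialSum≡sumBelow N rhsTerm (suc n) k ⟨
    partialSum N rhsTerm (suc n) k
  ∎
  where open ≡-Reasoning
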